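{- For any two compositions $\alpha$ and $\beta$, we have $F_\alpha\triangleright F_\beta=F_{\alpha\odot\beta}$.
   Context: Let $\mathbf{k}$ be a commutative ring and $\mathbf{k}[[x_1,x_2,\ldots]]$ the ring of formal power series in commuting indeterminates, with the product topology. For a monomial $\mathfrak m=x_1^{a_1}x_2^{a_2}\cdots$, $\mathrm{Supp}\,\mathfrak m=\{i:a_i>0\}$, with $\min\varnothing=\infty$, $\max\varnothing=0$. $\triangleright$ is the unique $\mathbf{k}$-bilinear continuous binary operation on $\mathbf{k}[[x_1,x_2,\ldots]]$ with $\mathfrak m\triangleright\mathfrak n=\mathfrak m\mathfrak n$ if $\max(\mathrm{Supp}\,\mathfrak m)\le\min(\mathrm{Supp}\,\mathfrak n)$ and $0$ otherwise, for monomials $\mathfrak m,\mathfrak n$. A composition is a finite sequence of positive integers; for a composition $\alpha=(\alpha_1,\ldots,\alpha_\ell)$ of $n$ (i.e. with sum $n$), $D(\alpha)=\{\alpha_1,\alpha_1+\alpha_2,\ldots,\alpha_1+\cdots+\alpha_{\ell-1}\}$ and $F_\alpha=\sum x_{i_1}x_{i_2}\cdots x_{i_n}$, summed over positive integers $i_1\le\cdots\le i_n$ with $i_j<i_{j+1}$ whenever $j\in D(\alpha)$ (so $F_\varnothing=1$). For compositions $\alpha,\beta$: $\alpha\odot\beta=\beta$ if $\alpha$ is empty; otherwise $\alpha\odot\beta=\alpha$ if $\beta$ is empty; otherwise $\alpha\odot\beta=(\alpha_1,\ldots,\alpha_{\ell-1},\alpha_\ell+\beta_1,\beta_2,\ldots,\beta_m)$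 for $\alpha=(\alpha_1,\ldots,\alpha_\ell)$, $\beta=(\beta_1,\ldots,\beta_m)$. -}

module Defs where

open import Level using (Level)
open import Algebra.Bundles using (CommutativeRing)
open import Data.Nat using (ℕ; zero; suc; _+_; _≤_; _<ᵇ_; _≡ᵇ_; _≤?_)
open import Data.Bool using (Bool; true; false; _∧_; if_then_else_)
open import Data.List.Base using (List; []; _∷_; map; length; take; drop; upTo; foldr; all)
open import Data.Nat.ListAction using (sum)
open import Relation.Nullary.Decidable using (⌊_⌋)

-- Compositions: finite lists of positive integers (positivity imposed as
-- a hypothesis  All (0 <_)  where used).
Composition : Set
Composition = List ℕ

-- Monomials x_{i_1} x_{i_2} ... x_{i_n} are represented canonically by the
-- weakly increasing list [i_1, ..., i_n] of positive variable indices.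
-- (A list is a monomial iff it satisfies  IsMonomial, see Statement.)

D : Composition → List ℕ
D []            = []
D (a ∷ [])      = []
D (a ∷ b ∷ r)   = a ∷ map (a +_) (D (b ∷ r))

-- strictAt [i_1,...,i_n] j  =  (i_j < i_{j+1})   (1-indexed j)
strictAt : List ℕ → ℕ → Bool
strictAt (x ∷ y ∷ r) 1             = x <ᵇ y
strictAt (x ∷ r)     (suc (suc k)) = strictAt r (suc k)
strictAt _           _             = false

_⊙_ : Composition → Composition → Composition
[]          ⊙ β       = β
(a ∷ [])    ⊙ []      = a ∷ []
(a ∷ [])    ⊙ (b ∷ β) = (a + b) ∷ β
(a ∷ a′ ∷ α) ⊙ β      = a ∷ ((a′ ∷ α) ⊙ β)

module _ {c ℓ : Level} (R : CommutativeRing c ℓ) where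
  open CommutativeRing R using (Carrier; 0#; 1#) renaming (_+_ to _+ᴿ_; _*_ to _*ᴿ_)

  -- A formal power series in x_1, x_2, ... over k is its coefficient
  -- function on monomials (given as weakly increasing index lists).
  PowerSeries : Set c
  PowerSeries = List ℕ → Carrier

  F : Composition → PowerSeries
  F α m = if (length m ≡ᵇ sum α) ∧ all (strictAt m) (D α) then 1# else 0#

  -- max(Supp m₁) ≤ min(Supp m₂)  (with max ∅ = 0, min ∅ = ∞), i.e.
  -- every index of m₁ is ≤ every index of m₂.
  suppLe : List ℕ → List ℕ → Bool
  suppLe m₁ m₂ = all (λ x → all (λ y → ⌊ x ≤? y ⌋) m₂) m₁

  -- The continuous bilinear extension of  𝔪 ▷ 𝔫 = 𝔪𝔫 if max Supp 𝔪 ≤ min Supp 𝔫, else 0: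
  -- the coefficient of 𝔪 in f ▷ g is the sum of f(𝔪₁) g(𝔪₂) over all factorizations
  -- 𝔪 = 𝔪₁𝔪₂ with max Supp 𝔪₁ ≤ min Supp 𝔪₂.  For 𝔪 = [i_1 ≤ ... ≤ i_n], the
  -- factorizations 𝔪 = 𝔪₁𝔪₂ satisfying the support condition are among the splits
  -- 𝔪₁ = [i_1..i_k], 𝔪₂ = [i_{k+1}..i_n] (k = 0..n), each arising once; we sum over
  -- these splits and keep those satisfying the support condition.
  _▷_ : PowerSeries → PowerSeries → PowerSeries
  (f ▷ g) m = foldr _+ᴿ_ 0#
    (map (λ k → if suppLe (take k m) (drop k m)
                  then f (take k m) *ᴿ g (drop k m) else 0#)
         (upTo (suc (length m))))

{-# OPTIONS --safe #-}
-- For a weakly increasing monomial m, every split of m into a prefix and a suffix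
-- satisfies the support condition of ▷, so (F_α ▷ F_β)(m) is the sum over k of
-- F_α(first k indices of m) · F_β(the remaining ones).  Since F_α vanishes off degree
-- |α|, only the split at k = |α| survives.  Because the parts of α are positive, D(α)
-- lies strictly between 0 and |α|, so the conditions of D(α) only see the prefix and
-- those of D(β), shifted by |α|, only the suffix; together they are the conditions
-- of D(α ⊙ β) = D(α) ∪ (|α| + D(β)) on m, and |α ⊙ β| = |α| + |β|.  The positivity
-- of the variable indices plays no role.
module Submission where

open import Defs
open import Level using (Level)
open import Algebra.Bundles using (CommutativeRing; CommutativeMonoid)
open import Data.Nat using (ℕ; _≤_; _<_)
open import Data.List using (List)
open import Data.List.Relation.Unary.All using (All)
open import Data.List.Relation.Unary.Linked using (Linked)

open import Data.Nat using (zero; suc; _+_; _∸_; _≡ᵇ_; _≤?_; z≤n; s≤s)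
open import Data.Nat.Properties
  using (+-identityʳ; +-assoc; +-suc; m<m+n; ≤-trans; m≤m+n; m≤n+m; +-monoʳ-<; m≤n⇒m⊓n≡m;
         suc-injective; ≤-pred; ≤-<-trans; ≰⇒>; <⇒≢; ≡ᵇ⇒≡)
open import Data.Nat.ListAction using (sum)
open import Data.Bool using (Bool; true; false; _∧_; if_then_else_; T)
open import Data.Bool.ListAction using (all; and)
open import Data.Bool.Properties using (∧-assoc; ∧-commutativeMonoid; T-≡; if-cong)
open import Data.List.Base using ([]; _∷_; map; length; take; drop; upTo; applyUpTo; foldr; _++_)
open import Data.List.Properties
  using (map-++; map-cong; map-cong-local; map-∘; map-id; map-upTo; length-take; length-drop)
open import Data.List.Relation.Unary.All using ([]; _∷_)
import Data.List.Relation.Unary.All as All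
open import Data.List.Relation.Unary.All.Properties using (map⁺; drop⁺; all⁻)
open import Data.List.Relation.Unary.AllPairs using (AllPairs; []; _∷_)
open import Data.List.Relation.Unary.Linked.Properties using (Linked⇒AllPairs)
open import Data.Product using (_×_; _,_)
open import Function using (_∘_; Equivalence)
open import Relation.Binary.Core using (Rel)
open import Relation.Nullary using (contradiction; yes; no)
open import Relation.Nullary.Decidable using (fromWitness)
open import Relation.Binary.PropositionalEquality
  using (_≡_; _≢_; refl; sym; trans; cong; cong₂; subst; module ≡-Reasoning)
open import Algebra.Properties.CommutativeSemigroup
  (CommutativeMonoid.commutativeSemigroup ∧-commutativeMonoid) using (x∙yz≈y∙xz)

map-+-map-+ : ∀ a b xs → map (a +_) (map (b +_) xs) ≡ map ((a + b) +_) xs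
map-+-map-+ a b xs = trans (sym (map-∘ xs)) (map-cong (λ x → sym (+-assoc a b x)) xs)

sum-⊙ : ∀ α β → sum (α ⊙ β) ≡ sum α + sum β
sum-⊙ []           β       = refl
sum-⊙ (a ∷ [])     []      = sym (+-identityʳ (a + 0))
sum-⊙ (a ∷ [])     (b ∷ β) =
  trans (+-assoc a b (sum β)) (cong (_+ (b + sum β)) (sym (+-identityʳ a)))
sum-⊙ (a ∷ a′ ∷ α) β       =
  trans (cong (a +_) (sum-⊙ (a′ ∷ α) β)) (sym (+-assoc a (sum (a′ ∷ α)) (sum β)))

D-∷ : ∀ a {γ} → γ ≢ [] → D (a ∷ γ) ≡ a ∷ map (a +_) (D γ)
D-∷ a {[]}    γ≢[] = contradiction refl γ≢[]
D-∷ a {_ ∷ _} _    = refl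

D-+ : ∀ a b β → D ((a + b) ∷ β) ≡ map (a +_) (D (b ∷ β))
D-+ a b []      = refl
D-+ a b (_ ∷ _) = cong ((a + b) ∷_) (sym (map-+-map-+ a b _))

∷-⊙-≢-[] : ∀ a α β → (a ∷ α) ⊙ β ≢ []
∷-⊙-≢-[] a []      []      ()
∷-⊙-≢-[] a []      (b ∷ β) ()
∷-⊙-≢-[] a (_ ∷ _) β       ()

D-⊙ : ∀ α β → D (α ⊙ β) ≡ D α ++ map (sum α +_) (D β)
D-⊙ []           β       = sym (map-id (D β))
D-⊙ (a ∷ [])     []      = refl
D-⊙ (a ∷ [])     (b ∷ β) =
  trans (D-+ a b β) (cong (λ s → map (s +_) (D (b ∷ β))) (sym (+-identityʳ a)))
D-⊙ (a ∷ a′ ∷ α) β       = begin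
  D (a ∷ (a′ ∷ α) ⊙ β)
    ≡⟨ D-∷ a (∷-⊙-≢-[] a′ α β) ⟩
  a ∷ map (a +_) (D ((a′ ∷ α) ⊙ β))
    ≡⟨ cong (λ ds → a ∷ map (a +_) ds) (D-⊙ (a′ ∷ α) β) ⟩
  a ∷ map (a +_) (D (a′ ∷ α) ++ map (s +_) (D β))
    ≡⟨ cong (a ∷_) (map-++ (a +_) (D (a′ ∷ α)) _) ⟩
  a ∷ map (a +_) (D (a′ ∷ α)) ++ map (a +_) (map (s +_) (D β))
    ≡⟨ cong (λ ds → a ∷ map (a +_) (D (a′ ∷ α)) ++ ds) (map-+-map-+ a s (D β)) ⟩
  a ∷ map (a +_) (D (a′ ∷ α)) ++ map ((a + s) +_) (D β)
    ∎
  where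
  open ≡-Reasoning
  s = sum (a′ ∷ α)

D-interior : ∀ {α} → All (0 <_) α → All (λ j → 0 < j × j < sum α) (D α)
D-interior {[]}        _                   = []
D-interior {a ∷ []}    _                   = []
D-interior {a ∷ b ∷ r} (0<a ∷ 0<b ∷ 0<r) =
  (0<a , m<m+n a (≤-trans 0<b (m≤m+n b (sum r))))
  ∷ map⁺ (All.map shift (D-interior (0<b ∷ 0<r)))
  where
  shift : ∀ {j} → 0 < j × j < sum (b ∷ r) → 0 < a + j × a + j < sum (a ∷ b ∷ r)
  shift {j} (0<j , j<s) = ≤-trans 0<j (m≤n+m j a) , +-monoʳ-< a j<s

strictAt-∷ : ∀ x r j → strictAt (x ∷ r) (suc (suc j)) ≡ strictAt r (suc j)
strictAt-∷ x []      j = refl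
strictAt-∷ x (_ ∷ _) j = refl

strictAt-take : ∀ m {j k} → 0 < j → j < k → strictAt (take k m) j ≡ strictAt m j
strictAt-take []          {k = suc _}                 _ _         = refl
strictAt-take (_ ∷ _)     {suc _}       {1}           _ (s≤s ())
strictAt-take (_ ∷ [])    {k = suc (suc _)}           _ _         = refl
strictAt-take (_ ∷ _ ∷ _) {1}           {suc (suc _)} _ _         = refl
strictAt-take (_ ∷ y ∷ r) {suc (suc j)} {suc (suc k)} _ (s≤s j<k) =
  strictAt-take (y ∷ r) {suc j} {suc k} (s≤s z≤n) j<k

strictAt-drop : ∀ m k {j} → 0 < j → strictAt (drop k m) j ≡ strictAt m (k + j)
strictAt-drop m       zero    _ = refl
strictAt-drop []      (suc k) _ = refl
strictAt-drop (x ∷ r) (suc k) {suc j} 0<j = begin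
  strictAt (drop k r) (suc j)            ≡⟨ strictAt-drop r k 0<j ⟩
  strictAt r (k + suc j)                 ≡⟨ cong (strictAt r) (+-suc k j) ⟩
  strictAt r (suc (k + j))               ≡⟨ strictAt-∷ x r (k + j) ⟨
  strictAt (x ∷ r) (suc (suc (k + j)))   ≡⟨ cong (strictAt (x ∷ r) ∘ suc) (+-suc k j) ⟨
  strictAt (x ∷ r) (suc k + suc j)       ∎
  where open ≡-Reasoning

all-++ : ∀ {a} {A : Set a} (p : A → Bool) xs ys → all p (xs ++ ys) ≡ all p xs ∧ all p ys
all-++ p []       ys = refl
all-++ p (x ∷ xs) ys = trans (cong (p x ∧_) (all-++ p xs ys)) (sym (∧-assoc (p x) _ _))

all-strictAt-take : ∀ m {α} → All (0 <_) α →
  all (strictAt (take (sum α) m)) (D α) ≡ all (strictAt m) (D α)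
all-strictAt-take m pα =
  cong and (map-cong-local (All.map (λ (0<j , j<a) → strictAt-take m 0<j j<a) (D-interior pα)))

all-strictAt-drop : ∀ m k {β} → All (0 <_) β →
  all (strictAt (drop k m)) (D β) ≡ all (strictAt m) (map (k +_) (D β))
all-strictAt-drop m k pβ = cong and (trans
  (map-cong-local (All.map (λ (0<j , _) → strictAt-drop m k 0<j) (D-interior pβ)))
  (map-∘ _))

∸-≡ᵇ-+ : ∀ {m n} o → n ≤ m → (m ∸ n ≡ᵇ o) ≡ (m ≡ᵇ n + o)
∸-≡ᵇ-+ o z≤n       = refl
∸-≡ᵇ-+ o (s≤s n≤m) = ∸-≡ᵇ-+ o n≤m

≡ᵇ-refl : ∀ n → (n ≡ᵇ n) ≡ true
≡ᵇ-refl zero    = refl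
≡ᵇ-refl (suc n) = ≡ᵇ-refl n

AllPairs-take-drop : ∀ {a r} {A : Set a} {R : Rel A r} {xs} k → AllPairs R xs →
  All (λ x → All (R x) (drop k xs)) (take k xs)
AllPairs-take-drop zero    _          = []
AllPairs-take-drop (suc k) []         = []
AllPairs-take-drop (suc k) (px ∷ pxs) = drop⁺ k px ∷ AllPairs-take-drop k pxs

monomialOfF : Composition → List ℕ → Bool
monomialOfF α m = (length m ≡ᵇ sum α) ∧ all (strictAt m) (D α)

monomialOfF-⊙ : ∀ {α β} → All (0 <_) α → All (0 <_) β → ∀ m → sum α ≤ length m →
  monomialOfF α (take (sum α) m) ∧ monomialOfF β (drop (sum α) m) ≡ monomialOfF (α ⊙ β) m
monomialOfF-⊙ {α} {β} pα pβ m a≤n = begin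
  monomialOfF α (take a m) ∧ monomialOfF β (drop a m)
    ≡⟨ cong₂ _∧_ (cong₂ _∧_ length-prefix (all-strictAt-take m pα))
                 (cong₂ _∧_ length-suffix (all-strictAt-drop m a pβ)) ⟩
  (true ∧ A) ∧ ((n ≡ᵇ a + b) ∧ B)
    ≡⟨ x∙yz≈y∙xz A (n ≡ᵇ a + b) B ⟩
  (n ≡ᵇ a + b) ∧ (A ∧ B)
    ≡⟨ cong₂ _∧_ (cong (n ≡ᵇ_) (sym (sum-⊙ α β)))
                 (sym (trans (cong (all (strictAt m)) (D-⊙ α β)) (all-++ _ (D α) _))) ⟩
  monomialOfF (α ⊙ β) m
    ∎
  where
  open ≡-Reasoning
  n = length m
  a = sum α
  b = sum β
  A = all (strictAt m) (D α)
  B = all (strictAt m) (map (a +_) (D β))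
  length-prefix : (length (take a m) ≡ᵇ a) ≡ true
  length-prefix = trans (cong (_≡ᵇ a) (trans (length-take a m) (m≤n⇒m⊓n≡m a≤n))) (≡ᵇ-refl a)
  length-suffix : (length (drop a m) ≡ᵇ b) ≡ (n ≡ᵇ a + b)
  length-suffix = trans (cong (_≡ᵇ b) (length-drop a m)) (∸-≡ᵇ-+ b a≤n)

module _ {c ℓ : Level} (R : CommutativeRing c ℓ) where
  open CommutativeRing R
    using (Carrier; 0#; 1#; _≈_; setoid; reflexive; +-cong; +-congˡ;
           *-congʳ; *-identityˡ; zeroˡ; zeroʳ)
    renaming (_+_ to _+ᴿ_; _*_ to _*ᴿ_; refl to ≈-refl;
              +-identityˡ to +ᴿ-identityˡ; +-identityʳ to +ᴿ-identityʳ)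
  open import Relation.Binary.Reasoning.Setoid setoid

  𝟙 : Bool → Carrier
  𝟙 b = if b then 1# else 0#

  𝟙-∧ : ∀ p q → 𝟙 p *ᴿ 𝟙 q ≈ 𝟙 (p ∧ q)
  𝟙-∧ true  true  = *-identityˡ 1#
  𝟙-∧ true  false = zeroʳ 1#
  𝟙-∧ false q     = zeroˡ (𝟙 q)

  Σ : List Carrier → Carrier
  Σ = foldr _+ᴿ_ 0#

  Σ-applyUpTo-≈0 : ∀ n (g : ℕ → Carrier) → (∀ i → i < n → g i ≈ 0#) → Σ (applyUpTo g n) ≈ 0#
  Σ-applyUpTo-≈0 zero    g g≈0 = ≈-refl
  Σ-applyUpTo-≈0 (suc n) g g≈0 = begin
    g 0 +ᴿ Σ (applyUpTo (g ∘ suc) n)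
      ≈⟨ +-cong (g≈0 0 (s≤s z≤n)) (Σ-applyUpTo-≈0 n (g ∘ suc) (λ i i<n → g≈0 (suc i) (s≤s i<n))) ⟩
    0# +ᴿ 0#
      ≈⟨ +ᴿ-identityˡ 0# ⟩
    0# ∎

  Σ-applyUpTo-single : ∀ n (g : ℕ → Carrier) {k} → k < n →
    (∀ i → i < n → i ≢ k → g i ≈ 0#) → Σ (applyUpTo g n) ≈ g k
  Σ-applyUpTo-single (suc n) g {zero} _ g≈0 = begin
    g 0 +ᴿ Σ (applyUpTo (g ∘ suc) n)
      ≈⟨ +-congˡ (Σ-applyUpTo-≈0 n (g ∘ suc) (λ i i<n → g≈0 (suc i) (s≤s i<n) λ ())) ⟩
    g 0 +ᴿ 0#
      ≈⟨ +ᴿ-identityʳ (g 0) ⟩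
    g 0 ∎
  Σ-applyUpTo-single (suc n) g {suc k} (s≤s k<n) g≈0 = begin
    g 0 +ᴿ Σ (applyUpTo (g ∘ suc) n)
      ≈⟨ +-cong (g≈0 0 (s≤s z≤n) λ ())
                (Σ-applyUpTo-single n (g ∘ suc) k<n
                  (λ i i<n i≢k → g≈0 (suc i) (s≤s i<n) (i≢k ∘ suc-injective))) ⟩
    0# +ᴿ g (suc k)
      ≈⟨ +ᴿ-identityˡ (g (suc k)) ⟩
    g (suc k) ∎

  suppLe-take-drop : ∀ {m} → AllPairs _≤_ m → ∀ k → suppLe R (take k m) (drop k m) ≡ true
  suppLe-take-drop sorted k = Equivalence.to T-≡
    (all⁻ _ (All.map (λ ≤-suffix → all⁻ _ (All.map fromWitness ≤-suffix))
                     (AllPairs-take-drop k sorted)))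

  splitTerm : PowerSeries R → PowerSeries R → List ℕ → ℕ → Carrier
  splitTerm f g m k = f (take k m) *ᴿ g (drop k m)

  ▷-sorted : ∀ f g {m} → AllPairs _≤_ m →
    _▷_ R f g m ≡ Σ (applyUpTo (splitTerm f g m) (suc (length m)))
  ▷-sorted f g {m} sorted = cong Σ (trans
    (map-cong (λ k → if-cong (suppLe-take-drop sorted k)) (upTo (suc (length m))))
    (map-upTo _ (suc (length m))))

  F-≢-length : ∀ α m → length m ≢ sum α → F R α m ≡ 0#
  F-≢-length α m ≢ with length m ≡ᵇ sum α in eq
  ... | true  = contradiction (≡ᵇ⇒≡ (length m) (sum α) (subst T (sym eq) _)) ≢
  ... | false = refl

  F-take-*-≈0 : ∀ α m {i} → i ≤ length m → i ≢ sum α → ∀ x → F R α (take i m) *ᴿ x ≈ 0#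
  F-take-*-≈0 α m {i} i≤n i≢a x = begin
    F R α (take i m) *ᴿ x  ≈⟨ *-congʳ (reflexive (F-≢-length α (take i m) length≢)) ⟩
    0# *ᴿ x                ≈⟨ zeroˡ x ⟩
    0#                     ∎
    where
    length≢ : length (take i m) ≢ sum α
    length≢ = i≢a ∘ trans (sym (trans (length-take i m) (m≤n⇒m⊓n≡m i≤n)))

  F-*-F-split : ∀ {α β} → All (0 <_) α → All (0 <_) β → ∀ m → sum α ≤ length m →
    F R α (take (sum α) m) *ᴿ F R β (drop (sum α) m) ≈ F R (α ⊙ β) m
  F-*-F-split {α} {β} pα pβ m a≤n = begin
    F R α (take (sum α) m) *ᴿ F R β (drop (sum α) m)  ≈⟨ 𝟙-∧ _ _ ⟩
    𝟙 (monomialOfF α (take (sum α) m) ∧ monomialOfF β (drop (sum α) m))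
      ≡⟨ cong 𝟙 (monomialOfF-⊙ pα pβ m a≤n) ⟩
    F R (α ⊙ β) m  ∎

  Σ-splitTerm-F-F : ∀ {α β} → All (0 <_) α → All (0 <_) β → ∀ m →
    Σ (applyUpTo (splitTerm (F R α) (F R β) m) (suc (length m))) ≈ F R (α ⊙ β) m
  Σ-splitTerm-F-F {α} {β} pα pβ m with sum α ≤? length m
  ... | yes a≤n = begin
    Σ (applyUpTo (splitTerm (F R α) (F R β) m) (suc (length m)))
      ≈⟨ Σ-applyUpTo-single (suc (length m)) _ (s≤s a≤n)
           (λ i i≤n i≢a → F-take-*-≈0 α m (≤-pred i≤n) i≢a (F R β (drop i m))) ⟩
    splitTerm (F R α) (F R β) m (sum α)
      ≈⟨ F-*-F-split pα pβ m a≤n ⟩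
    F R (α ⊙ β) m ∎
  ... | no a≰n = begin
    Σ (applyUpTo (splitTerm (F R α) (F R β) m) (suc (length m)))
      ≈⟨ Σ-applyUpTo-≈0 (suc (length m)) _
           (λ i i≤n → F-take-*-≈0 α m (≤-pred i≤n) (<⇒≢ (≤-<-trans (≤-pred i≤n) (≰⇒> a≰n)))
                                   (F R β (drop i m))) ⟩
    0#
      ≡⟨ F-≢-length (α ⊙ β) m n≢a+b ⟨
    F R (α ⊙ β) m ∎
    where
    n≢a+b : length m ≢ sum (α ⊙ β)
    n≢a+b n≡ = a≰n (subst (sum α ≤_) (trans (sym (sum-⊙ α β)) (sym n≡)) (m≤m+n (sum α) (sum β)))

proposition3p8 : {c ℓ : Level} (R : CommutativeRing c ℓ) →
    (α β : Composition) → All (0 <_) α → All (0 <_) β →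
    (m : List ℕ) → Linked _≤_ m → All (1 ≤_) m →
    CommutativeRing._≈_ R (_▷_ R (F R α) (F R β) m) (F R (α ⊙ β) m)
proposition3p8 R α β pα pβ m linked _ = begin
  _▷_ R (F R α) (F R β) m
    ≡⟨ ▷-sorted R (F R α) (F R β) (Linked⇒AllPairs ≤-trans linked) ⟩
  Σ R (applyUpTo (splitTerm R (F R α) (F R β) m) (suc (length m)))
    ≈⟨ Σ-splitTerm-F-F R pα pβ m ⟩
  F R (α ⊙ β) m ∎
  where open import Relation.Binary.Reasoning.Setoid (CommutativeRing.setoid R)
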